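{- $\mathsf{ParIso}(\mathsf{CTor}_2)^*$ is a discrete inverse category.
   Context: A torsor is a set $X$ with a ternary operation $(a,b,c)\mapsto a\times_b c$ satisfying $(a\times_b c)\times_d e=a\times_{d\times_c b}e=a\times_b(c\times_d e)$ and $a\times_b b=b\times_b a=a$; commutative if $a\times_b c=c\times_b a$; characteristic 2 if $a\times_b a=b$. $\mathsf{CTor}_2$ is the category of finitely generated commutative torsors of characteristic 2 (empty one included) with operation-preserving maps; it is finitely complete. For $\mathbb{X}$ with pullbacks, $\mathsf{Par}(\mathbb{X})$ has maps $A\to B$ the spans $A\xleftarrow{m}A'\xrightarrow{f}B$ with $m$ monic modulo isomorphism, composed by pullback, with restriction $\overline{(m,f)}=(m,m)$; $\mathsf{ParIso}(\mathbb{X})$ is its subcategory of partial isomorphisms (maps $f$ having $g$ with $fg=\overline f$, $gf=\overline g$); $\mathsf{ParIso}(\mathsf{CTor}_2)^*$ is $\mathsf{ParIso}(\mathsf{CTor}_2)$ with the empty torsor removed. An inverse category is a category with an identity-on-objects involution $(-)^\circ:\mathbb{X}^{op}\to\mathbb{X}$ with $(c^\circ)^\circ=c$, $cc^\circ c=c$, $cc^\circ dd^\circ=dd^\circ cc^\circ$ (composition diagrammatic; restriction $\overline c=cc^\circ$). It has inverse products if it has a tensor product $\otimes$ preserving $(-)^\circ$ and a total natural transformation $\Delta_A:A\to A\otimes A$ that is cocommutative, coassociative, forms with $\Delta_A^\circ$ a semi-Frobenius structure ($(\Delta_A\otimes1)a(1\otimes\Delta_A^\circ)=\Delta_A^\circ\Delta_A=(1\otimes\Delta_A)a^\circ(\Delta_A^\circ\otimes1)$),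 and satisfies uniform copying $\Delta_{A\otimes B}=(\Delta_A\otimes\Delta_B)\mathsf{ex}_{A,B}$ with $\mathsf{ex}$ the canonical middle-exchange isomorphism. A discrete inverse category is an inverse category with inverse products. -}

module Defs where

open import Level using (Level; _⊔_) renaming (suc to lsuc; zero to lzero)
open import Data.Product using (Σ; _×_; _,_; proj₁; proj₂)
open import Data.List using (List)
open import Data.List.Membership.Propositional using (_∈_)
open import Data.Empty using (⊥)
open import Relation.Nullary using (¬_)
open import Relation.Binary.PropositionalEquality using (_≡_; refl; trans; cong)

-- Torsors.  op a b c  stands for  a ×_b c.

record Torsor : Set₁ where
  field
    Carrier : Set
    op      : Carrier → Carrier → Carrier → Carrier
    assoc₁  : ∀ a b c d e → op (op a b c) d e ≡ op a (op d c b) e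
    assoc₂  : ∀ a b c d e → op a (op d c b) e ≡ op a b (op c d e)
    unitʳ   : ∀ a b → op a b b ≡ a
    unitˡ   : ∀ a b → op b b a ≡ a

IsCommutative : Torsor → Set
IsCommutative T = ∀ a b c → op a b c ≡ op c b a
  where open Torsor T

IsChar2 : Torsor → Set
IsChar2 T = ∀ a b → op a b a ≡ b
  where open Torsor T

data Gen (T : Torsor) (gs : List (Torsor.Carrier T)) : Torsor.Carrier T → Set where
  gen : ∀ {x} → x ∈ gs → Gen T gs x
  app : ∀ {a b c} → Gen T gs a → Gen T gs b → Gen T gs c → Gen T gs (Torsor.op T a b c)

FinitelyGenerated : Torsor → Set
FinitelyGenerated T = Σ (List (Torsor.Carrier T)) λ gs → ∀ x → Gen T gs x

-- The category CTor₂ (empty torsor included).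

record CTor2 : Set₁ where
  field
    tor   : Torsor
    comm  : IsCommutative tor
    char2 : IsChar2 tor
    fg    : FinitelyGenerated tor
  open Torsor tor public

record _⇒_ (X Y : CTor2) : Set where
  field
    fun  : CTor2.Carrier X → CTor2.Carrier Y
    pres : ∀ a b c → fun (CTor2.op X a b c) ≡ CTor2.op Y (fun a) (fun b) (fun c)
open _⇒_ public

infix 4 _≗ₕ_
_≗ₕ_ : ∀ {X Y} → X ⇒ Y → X ⇒ Y → Set
f ≗ₕ g = ∀ x → fun f x ≡ fun g x

idH : ∀ {X} → X ⇒ X
idH = record { fun = λ x → x ; pres = λ _ _ _ → refl }

-- diagrammatic composition: f ∙ g  is "first f, then g"
infixr 9 _∙_
_∙_ : ∀ {X Y Z} → X ⇒ Y → Y ⇒ Z → X ⇒ Z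
f ∙ g = record
  { fun  = λ x → fun g (fun f x)
  ; pres = λ a b c → trans (cong (fun g) (pres f a b c)) (pres g _ _ _) }

Mono : ∀ {X Y} → X ⇒ Y → Set₁
Mono {X} m = ∀ {C : CTor2} (g h : C ⇒ X) → (g ∙ m) ≗ₕ (h ∙ m) → g ≗ₕ h

IsPullback : ∀ {X Y Z P} (f : X ⇒ Z) (g : Y ⇒ Z) (p : P ⇒ X) (q : P ⇒ Y) → Set₁
IsPullback {X} {Y} {Z} {P} f g p q =
  ((p ∙ f) ≗ₕ (q ∙ g)) ×
  (∀ {C : CTor2} (u : C ⇒ X) (v : C ⇒ Y) → (u ∙ f) ≗ₕ (v ∙ g) →
     Σ (C ⇒ P) λ k → ((k ∙ p) ≗ₕ u) × ((k ∙ q) ≗ₕ v) ×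
       (∀ (k' : C ⇒ P) → (k' ∙ p) ≗ₕ u → (k' ∙ q) ≗ₕ v → k' ≗ₕ k))

-- Par(CTor₂): spans  A <-m- A' -f-> B  with m monic, modulo isomorphism.

record Span (A B : CTor2) : Set₁ where
  field
    apex : CTor2
    leg  : apex ⇒ A
    mono : Mono leg
    map  : apex ⇒ B
open Span public

record SpanEq {A B} (s t : Span A B) : Set where
  field
    to      : apex s ⇒ apex t
    from    : apex t ⇒ apex s
    to-from : (to ∙ from) ≗ₕ idH
    from-to : (from ∙ to) ≗ₕ idH
    leg-eq  : (to ∙ leg t) ≗ₕ leg s
    map-eq  : (to ∙ map t) ≗ₕ map s

idSpan : ∀ A → Span A A
idSpan A = record { apex = A ; leg = idH ; mono = λ g h e → e ; map = idH }

restr : ∀ {A B} → Span A B → Span A A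
restr s = record { apex = apex s ; leg = leg s ; mono = mono s ; map = leg s }

IsComposite : ∀ {A B C} → Span A B → Span B C → Span A C → Set₁
IsComposite s t u =
  Σ (apex u ⇒ apex s) λ p → Σ (apex u ⇒ apex t) λ q →
    IsPullback (map s) (leg t) p q ×
    ((p ∙ leg s) ≗ₕ leg u) × ((q ∙ map t) ≗ₕ map u)

Compositor : Set₁
Compositor = ∀ {A B C} → Span A B → Span B C → Span A C

IsCompositor : Compositor → Set₁
IsCompositor comp = ∀ {A B C} (s : Span A B) (t : Span B C) → IsComposite s t (comp s t)

IsParIso : Compositor → ∀ {A B} → Span A B → Set₁
IsParIso comp {A} {B} s =
  Σ (Span B A) λ t → SpanEq (comp s t) (restr s) × SpanEq (comp t s) (restr t)

record ParIsoClosed (comp : Compositor) : Set₁ where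
  field
    idP   : ∀ A → IsParIso comp (idSpan A)
    compP : ∀ {A B C} {s : Span A B} {t : Span B C} →
            IsParIso comp s → IsParIso comp t → IsParIso comp (comp s t)

NonEmpty : CTor2 → Set
NonEmpty X = ¬ (CTor2.Carrier X → ⊥)

-- Categories with setoid hom-sets (composition diagrammatic).

record CatData (o h e : Level) : Set (lsuc (o ⊔ h ⊔ e)) where
  infixr 9 _⨾_
  infix 4 _≈_
  field
    Obj : Set o
    Hom : Obj → Obj → Set h
    _≈_ : ∀ {A B} → Hom A B → Hom A B → Set e
    id  : ∀ {A} → Hom A A
    _⨾_ : ∀ {A B C} → Hom A B → Hom B C → Hom A C

record IsCategory {o h e} (𝒞 : CatData o h e) : Set (o ⊔ h ⊔ e) where
  open CatData 𝒞
  field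
    ≈-refl  : ∀ {A B} {f : Hom A B} → f ≈ f
    ≈-sym   : ∀ {A B} {f g : Hom A B} → f ≈ g → g ≈ f
    ≈-trans : ∀ {A B} {f g k : Hom A B} → f ≈ g → g ≈ k → f ≈ k
    ⨾-cong  : ∀ {A B C} {f f' : Hom A B} {g g' : Hom B C} → f ≈ f' → g ≈ g' → (f ⨾ g) ≈ (f' ⨾ g')
    idˡ     : ∀ {A B} (f : Hom A B) → (id ⨾ f) ≈ f
    idʳ     : ∀ {A B} (f : Hom A B) → (f ⨾ id) ≈ f
    assoc   : ∀ {A B C D} (f : Hom A B) (g : Hom B C) (k : Hom C D) → ((f ⨾ g) ⨾ k) ≈ (f ⨾ (g ⨾ k))

record DiscreteInverse {o h e} (𝒞 : CatData o h e) : Set (o ⊔ h ⊔ e) where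
  open CatData 𝒞
  infixr 10 _⊗₀_ _⊗₁_
  field
    _°     : ∀ {A B} → Hom A B → Hom B A
    °-cong : ∀ {A B} {f g : Hom A B} → f ≈ g → (f °) ≈ (g °)
    °-id   : ∀ {A} → ((id {A}) °) ≈ id
    °-⨾    : ∀ {A B C} (f : Hom A B) (g : Hom B C) → ((f ⨾ g) °) ≈ ((g °) ⨾ (f °))
    °-°    : ∀ {A B} (c : Hom A B) → ((c °) °) ≈ c
    c°c    : ∀ {A B} (c : Hom A B) → (c ⨾ (c °) ⨾ c) ≈ c
    restr-comm : ∀ {A B C} (c : Hom A B) (d : Hom A C) →
                 ((c ⨾ (c °)) ⨾ (d ⨾ (d °))) ≈ ((d ⨾ (d °)) ⨾ (c ⨾ (c °)))
    _⊗₀_   : Obj → Obj → Obj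
    _⊗₁_   : ∀ {A B C D} → Hom A B → Hom C D → Hom (A ⊗₀ C) (B ⊗₀ D)
    I      : Obj
    ⊗-cong : ∀ {A B C D} {f f' : Hom A B} {g g' : Hom C D} → f ≈ f' → g ≈ g' → (f ⊗₁ g) ≈ (f' ⊗₁ g')
    ⊗-id   : ∀ {A B} → ((id {A}) ⊗₁ (id {B})) ≈ id
    ⊗-⨾    : ∀ {A₁ A₂ A₃ B₁ B₂ B₃} (f : Hom A₁ A₂) (g : Hom A₂ A₃) (f' : Hom B₁ B₂) (g' : Hom B₂ B₃) →
             ((f ⨾ g) ⊗₁ (f' ⨾ g')) ≈ ((f ⊗₁ f') ⨾ (g ⊗₁ g'))
    α      : ∀ A B C → Hom ((A ⊗₀ B) ⊗₀ C) (A ⊗₀ (B ⊗₀ C))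
    α⁻¹    : ∀ A B C → Hom (A ⊗₀ (B ⊗₀ C)) ((A ⊗₀ B) ⊗₀ C)
    lu     : ∀ A → Hom (I ⊗₀ A) A
    lu⁻¹   : ∀ A → Hom A (I ⊗₀ A)
    ru     : ∀ A → Hom (A ⊗₀ I) A
    ru⁻¹   : ∀ A → Hom A (A ⊗₀ I)
    σ      : ∀ A B → Hom (A ⊗₀ B) (B ⊗₀ A)
    α-iso₁ : ∀ A B C → (α A B C ⨾ α⁻¹ A B C) ≈ id
    α-iso₂ : ∀ A B C → (α⁻¹ A B C ⨾ α A B C) ≈ id
    lu-iso₁ : ∀ A → (lu A ⨾ lu⁻¹ A) ≈ id
    lu-iso₂ : ∀ A → (lu⁻¹ A ⨾ lu A) ≈ id
    ru-iso₁ : ∀ A → (ru A ⨾ ru⁻¹ A) ≈ id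
    ru-iso₂ : ∀ A → (ru⁻¹ A ⨾ ru A) ≈ id
    σ-inv  : ∀ A B → (σ A B ⨾ σ B A) ≈ id
    α-nat  : ∀ {A₁ A₂ A₃ B₁ B₂ B₃} (f : Hom A₁ B₁) (g : Hom A₂ B₂) (k : Hom A₃ B₃) →
             (((f ⊗₁ g) ⊗₁ k) ⨾ α B₁ B₂ B₃) ≈ (α A₁ A₂ A₃ ⨾ (f ⊗₁ (g ⊗₁ k)))
    lu-nat : ∀ {A B} (f : Hom A B) → ((id {I} ⊗₁ f) ⨾ lu B) ≈ (lu A ⨾ f)
    ru-nat : ∀ {A B} (f : Hom A B) → ((f ⊗₁ id {I}) ⨾ ru B) ≈ (ru A ⨾ f)
    σ-nat  : ∀ {A₁ A₂ B₁ B₂} (f : Hom A₁ B₁) (g : Hom A₂ B₂) →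
             ((f ⊗₁ g) ⨾ σ B₁ B₂) ≈ (σ A₁ A₂ ⨾ (g ⊗₁ f))
    pentagon : ∀ A B C D →
             (α (A ⊗₀ B) C D ⨾ α A B (C ⊗₀ D)) ≈
             ((α A B C ⊗₁ id) ⨾ α A (B ⊗₀ C) D ⨾ (id ⊗₁ α B C D))
    triangle : ∀ A B → (α A I B ⨾ (id ⊗₁ lu B)) ≈ (ru A ⊗₁ id)
    hexagon  : ∀ A B C →
             (α A B C ⨾ σ A (B ⊗₀ C) ⨾ α B C A) ≈
             ((σ A B ⊗₁ id) ⨾ α B A C ⨾ (id ⊗₁ σ A C))
    ⊗-° : ∀ {A B C D} (f : Hom A B) (g : Hom C D) → ((f ⊗₁ g) °) ≈ ((f °) ⊗₁ (g °))
    Δ        : ∀ A → Hom A (A ⊗₀ A)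
    Δ-total  : ∀ A → (Δ A ⨾ (Δ A °)) ≈ id
    Δ-nat    : ∀ {A B} (f : Hom A B) → (f ⨾ Δ B) ≈ (Δ A ⨾ (f ⊗₁ f))
    Δ-cocomm : ∀ A → (Δ A ⨾ σ A A) ≈ Δ A
    Δ-coassoc : ∀ A → (Δ A ⨾ (Δ A ⊗₁ id) ⨾ α A A A) ≈ (Δ A ⨾ (id ⊗₁ Δ A))
    Δ-frob₁  : ∀ A → ((Δ A ⊗₁ id) ⨾ α A A A ⨾ (id ⊗₁ (Δ A °))) ≈ ((Δ A °) ⨾ Δ A)
    Δ-frob₂  : ∀ A → ((Δ A °) ⨾ Δ A) ≈ ((id ⊗₁ Δ A) ⨾ (α A A A °) ⨾ ((Δ A °) ⊗₁ id))
    Δ-uniform : ∀ A B → Δ (A ⊗₀ B) ≈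
             ((Δ A ⊗₁ Δ B) ⨾ α A A (B ⊗₀ B) ⨾ (id ⊗₁ α⁻¹ A B B) ⨾
              (id ⊗₁ (σ A B ⊗₁ id)) ⨾ (id ⊗₁ α B A B) ⨾ α⁻¹ A B (A ⊗₀ B))

ParIsoStar : (comp : Compositor) → ParIsoClosed comp → CatData (lsuc lzero) (lsuc lzero) lzero
ParIsoStar comp cl = record
  { Obj = Σ CTor2 NonEmpty
  ; Hom = λ A B → Σ (Span (proj₁ A) (proj₁ B)) (IsParIso comp)
  ; _≈_ = λ f g → SpanEq (proj₁ f) (proj₁ g)
  ; id  = λ {A} → idSpan (proj₁ A) , ParIsoClosed.idP cl (proj₁ A)
  ; _⨾_ = λ f g → comp (proj₁ f) (proj₁ g) , ParIsoClosed.compP cl (proj₂ f) (proj₂ g)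
  }

module Submission where

-- A span A ← A′ → B of CTor₂ with monic leg is determined, up to isomorphism, by the
-- relation {(m x , f x)} it induces between carriers: monos are injective (test them against
-- the one-point torsor), and a function between apexes commuting with injective legs
-- automatically preserves the operation. Pullback composition induces relational composition,
-- and a span is a partial isomorphism exactly when its relation is injective, the reversed
-- span being its inverse. So ParIso(CTor₂)* is represented faithfully by partial injections
-- between carriers, the tensor by the cartesian product of torsors and Δ by the graph of the
-- diagonal, and every axiom of a discrete inverse category becomes an elementary identity
-- between relations.

open import Data.Empty using (⊥)
open import Data.List using (_∷_; []; cartesianProduct)
open import Data.List.Membership.Propositional.Properties using (∈-cartesianProduct⁺)
open import Data.List.Relation.Unary.Any using (here)
open import Data.Product using (Σ; _×_; _,_; proj₁; proj₂; assocʳ′; assocˡ′; swap)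
open import Data.Product.Relation.Binary.Pointwise.NonDependent using (Pointwise)
open import Data.Unit using (⊤; tt)
open import Function using (flip)
open import Function.Definitions using (Injective)
open import Level using (0ℓ)
open import Relation.Binary.Core using (REL; _⇔_) renaming (_⇒_ to _⊆_)
open import Relation.Binary.Construct.Composition using (_;_)
open import Relation.Binary.PropositionalEquality
  using (_≡_; refl; sym; trans; cong; cong₂; subst; module ≡-Reasoning)

open import Defs

open CTor2 using (Carrier)

point : CTor2
point = record
  { tor   = record
    { Carrier = ⊤ ; op = λ _ _ _ → tt
    ; assoc₁ = λ _ _ _ _ _ → refl ; assoc₂ = λ _ _ _ _ _ → refl
    ; unitʳ = λ _ _ → refl ; unitˡ = λ _ _ → refl }
  ; comm  = λ _ _ _ → refl
  ; char2 = λ _ _ → refl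
  ; fg    = tt ∷ [] , λ _ → gen (here refl) }

const : (X : CTor2) → Carrier X → point ⇒ X
const X x = record { fun = λ _ → x ; pres = λ _ _ _ → sym (CTor2.unitʳ X x x) }

mono⇒injective : ∀ {X Y} {m : X ⇒ Y} → Mono m → Injective _≡_ _≡_ (fun m)
mono⇒injective {X} m-mono {x} {y} mx≡my = m-mono (const X x) (const X y) (λ _ → mx≡my) tt

injective⇒mono : ∀ {X Y} {m : X ⇒ Y} → Injective _≡_ _≡_ (fun m) → Mono m
injective⇒mono m-injective g h gm≗hm c = m-injective (gm≗hm c)

factor-through-injective : ∀ {X Y Z} (m : Y ⇒ Z) → Injective _≡_ _≡_ (fun m) →
                           (h : X ⇒ Z) (k : Carrier X → Carrier Y) →
                           (∀ x → fun m (k x) ≡ fun h x) → X ⇒ Y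
factor-through-injective {X} {Y} {Z} m m-injective h k mk≗h = record
  { fun  = k
  ; pres = λ a b c → m-injective (begin
      fun m (k (X.op a b c))                ≡⟨ mk≗h _ ⟩
      fun h (X.op a b c)                    ≡⟨ pres h a b c ⟩
      Z.op (fun h a) (fun h b) (fun h c)    ≡⟨ sym (cong₂ (λ u v → Z.op u v _) (mk≗h a) (mk≗h b)) ⟩
      Z.op (fun m (k a)) (fun m (k b)) (fun h c)
                                            ≡⟨ sym (cong (Z.op _ _) (mk≗h c)) ⟩
      Z.op (fun m (k a)) (fun m (k b)) (fun m (k c))
                                            ≡⟨ sym (pres m _ _ _) ⟩
      fun m (Y.op (k a) (k b) (k c))        ∎) }
  where
  module X = CTor2 X
  module Z = CTor2 Z
  module Y = CTor2 Y
  open ≡-Reasoning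

module _ (X Y : CTor2) where
  private
    module X = CTor2 X
    module Y = CTor2 Y

  productTorsor : Torsor
  productTorsor = record
    { Carrier = Carrier X × Carrier Y
    ; op      = λ p q r → X.op (proj₁ p) (proj₁ q) (proj₁ r) , Y.op (proj₂ p) (proj₂ q) (proj₂ r)
    ; assoc₁  = λ _ _ _ _ _ → cong₂ _,_ (X.assoc₁ _ _ _ _ _) (Y.assoc₁ _ _ _ _ _)
    ; assoc₂  = λ _ _ _ _ _ → cong₂ _,_ (X.assoc₂ _ _ _ _ _) (Y.assoc₂ _ _ _ _ _)
    ; unitʳ   = λ _ _ → cong₂ _,_ (X.unitʳ _ _) (Y.unitʳ _ _)
    ; unitˡ   = λ _ _ → cong₂ _,_ (X.unitˡ _ _) (Y.unitˡ _ _) }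

  -- a ×_a a = a lets one coordinate move while the other is held fixed.
  Gen-pair : ∀ {xs ys a b} → Gen X.tor xs a → Gen Y.tor ys b →
             Gen productTorsor (cartesianProduct xs ys) (a , b)
  Gen-pair (gen a∈xs) (gen b∈ys) = gen (∈-cartesianProduct⁺ a∈xs b∈ys)
  Gen-pair {a = a} ga@(gen _) (app gb₁ gb₂ gb₃) =
    subst (λ a′ → Gen productTorsor _ (a′ , _)) (X.unitʳ a a)
          (app (Gen-pair ga gb₁) (Gen-pair ga gb₂) (Gen-pair ga gb₃))
  Gen-pair {b = b} (app ga₁ ga₂ ga₃) gb =
    subst (λ b′ → Gen productTorsor _ (_ , b′)) (Y.unitʳ b b)
          (app (Gen-pair ga₁ gb) (Gen-pair ga₂ gb) (Gen-pair ga₃ gb))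

  productFinitelyGenerated : FinitelyGenerated productTorsor
  productFinitelyGenerated =
    cartesianProduct (proj₁ X.fg) (proj₁ Y.fg) ,
    λ p → Gen-pair (proj₂ X.fg (proj₁ p)) (proj₂ Y.fg (proj₂ p))

infixr 10 _×ᶜ_ _×ʰ_
_×ᶜ_ : CTor2 → CTor2 → CTor2
X ×ᶜ Y = record
  { tor   = productTorsor X Y
  ; comm  = λ _ _ _ → cong₂ _,_ (CTor2.comm X _ _ _) (CTor2.comm Y _ _ _)
  ; char2 = λ _ _ → cong₂ _,_ (CTor2.char2 X _ _) (CTor2.char2 Y _ _)
  ; fg    = productFinitelyGenerated X Y }

_×ʰ_ : ∀ {X Y Z W} → X ⇒ Y → Z ⇒ W → (X ×ᶜ Z) ⇒ (Y ×ᶜ W)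
f ×ʰ g = record { fun = λ p → fun f (proj₁ p) , fun g (proj₂ p)
                ; pres = λ _ _ _ → cong₂ _,_ (pres f _ _ _) (pres g _ _ _) }

duplicate : {A : Set} → A → A × A
duplicate x = x , x

module _ {X Y Z : CTor2} where

  assocʳʰ : ((X ×ᶜ Y) ×ᶜ Z) ⇒ (X ×ᶜ (Y ×ᶜ Z))
  assocʳʰ = record { fun = assocʳ′ ; pres = λ _ _ _ → refl }

  assocˡʰ : (X ×ᶜ (Y ×ᶜ Z)) ⇒ ((X ×ᶜ Y) ×ᶜ Z)
  assocˡʰ = record { fun = assocˡ′ ; pres = λ _ _ _ → refl }

module _ {X Y : CTor2} where

  swapʰ : (X ×ᶜ Y) ⇒ (Y ×ᶜ X)
  swapʰ = record { fun = swap ; pres = λ _ _ _ → refl }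

module _ {X : CTor2} where

  proj₁ʰ : (X ×ᶜ point) ⇒ X
  proj₁ʰ = record { fun = proj₁ ; pres = λ _ _ _ → refl }

  proj₂ʰ : (point ×ᶜ X) ⇒ X
  proj₂ʰ = record { fun = proj₂ ; pres = λ _ _ _ → refl }

  insertʳʰ : X ⇒ (X ×ᶜ point)
  insertʳʰ = record { fun = λ x → x , tt ; pres = λ _ _ _ → refl }

  insertˡʰ : X ⇒ (point ×ᶜ X)
  insertˡʰ = record { fun = λ x → tt , x ; pres = λ _ _ _ → refl }

  duplicateʰ : X ⇒ (X ×ᶜ X)
  duplicateʰ = record { fun = duplicate ; pres = λ _ _ _ → refl }

Graph : {A B : Set} → (A → B) → REL A B 0ℓ
Graph f a b = f a ≡ b

Functional : {A B : Set} → REL A B 0ℓ → Set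
Functional R = ∀ {a b b′} → R a b → R a b′ → b ≡ b′

Injectiveᴿ : {A B : Set} → REL A B 0ℓ → Set
Injectiveᴿ R = ∀ {a a′ b} → R a b → R a′ b → a ≡ a′

module _ {A B : Set} where

  ⇔-refl : {R : REL A B 0ℓ} → R ⇔ R
  ⇔-refl = (λ r → r) , (λ r → r)

  ⇔-sym : {R S : REL A B 0ℓ} → R ⇔ S → S ⇔ R
  ⇔-sym (R⊆S , S⊆R) = S⊆R , R⊆S

  ⇔-trans : {R S T : REL A B 0ℓ} → R ⇔ S → S ⇔ T → R ⇔ T
  ⇔-trans (R⊆S , S⊆R) (S⊆T , T⊆S) = (λ r → S⊆T (R⊆S r)) , (λ t → S⊆R (T⊆S t))

  ;-identityˡ : {R : REL A B 0ℓ} → (_≡_ ; R) ⇔ R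
  ;-identityˡ = (λ { (_ , refl , r) → r }) , (λ r → _ , refl , r)

  ;-identityʳ : {R : REL A B 0ℓ} → (R ; _≡_) ⇔ R
  ;-identityʳ = (λ { (_ , r , refl) → r }) , (λ r → _ , r , refl)

  flip-cong : {R S : REL A B 0ℓ} → R ⇔ S → flip R ⇔ flip S
  flip-cong (R⊆S , S⊆R) = R⊆S , S⊆R

  Graph-cong : {f g : A → B} → (∀ x → f x ≡ g x) → Graph f ⇔ Graph g
  Graph-cong f≗g = (λ fx≡y → trans (sym (f≗g _)) fx≡y) , (λ gx≡y → trans (f≗g _) gx≡y)

  Injectiveᴿ-resp-⇔ : {R S : REL A B 0ℓ} → R ⇔ S → Injectiveᴿ S → Injectiveᴿ R
  Injectiveᴿ-resp-⇔ (R⊆S , _) S-injective r r′ = S-injective (R⊆S r) (R⊆S r′)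

;-cong : {A B C : Set} {R R′ : REL A B 0ℓ} {S S′ : REL B C 0ℓ} →
         R ⇔ R′ → S ⇔ S′ → (R ; S) ⇔ (R′ ; S′)
;-cong (R⊆R′ , R′⊆R) (S⊆S′ , S′⊆S) =
  (λ (b , r , s) → b , R⊆R′ r , S⊆S′ s) , (λ (b , r , s) → b , R′⊆R r , S′⊆S s)

Pointwise-cong : {A B C D : Set} {R R′ : REL A B 0ℓ} {S S′ : REL C D 0ℓ} →
                 R ⇔ R′ → S ⇔ S′ → Pointwise R S ⇔ Pointwise R′ S′
Pointwise-cong (R⊆R′ , R′⊆R) (S⊆S′ , S′⊆S) =
  (λ (r , s) → R⊆R′ r , S⊆S′ s) , (λ (r , s) → R′⊆R r , S′⊆S s)

Injectiveᴿ-; : {A B C : Set} {R : REL A B 0ℓ} {S : REL B C 0ℓ} →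
               Injectiveᴿ R → Injectiveᴿ S → Injectiveᴿ (R ; S)
Injectiveᴿ-; R-injective S-injective (_ , r , s) (_ , r′ , s′)
  with refl ← S-injective s s′ = R-injective r r′

Injectiveᴿ-Pointwise : {A B C D : Set} {R : REL A B 0ℓ} {S : REL C D 0ℓ} →
                       Injectiveᴿ R → Injectiveᴿ S → Injectiveᴿ (Pointwise R S)
Injectiveᴿ-Pointwise R-injective S-injective (r , s) (r′ , s′) =
  cong₂ _,_ (R-injective r r′) (S-injective s s′)

module _ {A B C : Set} where

  Graph-; : {f : A → B} {g : B → C} → (Graph f ; Graph g) ⇔ Graph (λ x → g (f x))
  Graph-; = (λ { (_ , refl , gfx≡c) → gfx≡c }) , (λ gfx≡c → _ , refl , gfx≡c)

  flip-; : {R : REL A B 0ℓ} {S : REL B C 0ℓ} → flip (R ; S) ⇔ (flip S ; flip R)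
  flip-; = (λ (b , r , s) → b , s , r) , (λ (b , s , r) → b , r , s)

  restrictions-commute : {R : REL A B 0ℓ} {S : REL A C 0ℓ} → Injectiveᴿ R → Injectiveᴿ S →
                         ((R ; flip R) ; (S ; flip S)) ⊆ ((S ; flip S) ; (R ; flip R))
  restrictions-commute R-injective S-injective (_ , (b , r , r′) , (c , s , s′))
    with refl ← R-injective r r′ | refl ← S-injective s s′ = _ , (c , s , s) , (b , r , r)

;-assoc : {A B C D : Set} {R : REL A B 0ℓ} {S : REL B C 0ℓ} {T : REL C D 0ℓ} →
           ((R ; S) ; T) ⇔ (R ; (S ; T))
;-assoc = (λ (c , (b , r , s) , t) → b , r , c , s , t) , (λ (b , r , c , s , t) → c , (b , r , s) , t)

flip-≡ : {A : Set} → flip (_≡_ {A = A}) ⇔ _≡_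
flip-≡ = sym , sym

;-flip-;-injective : {A B : Set} {R : REL A B 0ℓ} → Injectiveᴿ R → (R ; (flip R ; R)) ⇔ R
;-flip-;-injective {R = R} R-injective =
  (λ { (_ , r , _ , r′ , r″) → subst (λ a → R a _) (sym (R-injective r r′)) r″ }) ,
  (λ r → _ , r , _ , r , r)

module _ {A B C D : Set} where

  Graph-Pointwise : {f : A → B} {g : C → D} →
                    Pointwise (Graph f) (Graph g) ⇔ Graph (λ p → f (proj₁ p) , g (proj₂ p))
  Graph-Pointwise = (λ (fa≡b , gc≡d) → cong₂ _,_ fa≡b gc≡d) , (λ fg≡bd → cong proj₁ fg≡bd , cong proj₂ fg≡bd)

  flip-Pointwise : {R : REL A B 0ℓ} {S : REL C D 0ℓ} → flip (Pointwise R S) ⇔ Pointwise (flip R) (flip S)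
  flip-Pointwise = (λ rs → rs) , (λ rs → rs)

  swap-natural : {R : REL A B 0ℓ} {S : REL C D 0ℓ} →
                 (Pointwise R S ; Graph swap) ⇔ (Graph swap ; Pointwise S R)
  swap-natural = (λ { (_ , (r , s) , refl) → _ , refl , s , r }) ,
                 (λ { (_ , refl , s , r) → _ , (r , s) , refl })

module _ {A B C : Set} where

  proj₂-natural : {R : REL B C 0ℓ} → (Pointwise (_≡_ {A = A}) R ; Graph proj₂) ⇔ (Graph proj₂ ; R)
  proj₂-natural = (λ { (_ , (refl , r) , refl) → _ , refl , r }) ,
                  (λ { (_ , refl , r) → _ , (refl , r) , refl })

  proj₁-natural : {R : REL B C 0ℓ} → (Pointwise R (_≡_ {A = A}) ; Graph proj₁) ⇔ (Graph proj₁ ; R)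
  proj₁-natural = (λ { (_ , (r , refl) , refl) → _ , refl , r }) ,
                  (λ { (_ , refl , r) → _ , (r , refl) , refl })

module _ {A B C A′ B′ C′ : Set} where

  Pointwise-; : {R : REL A B 0ℓ} {S : REL B C 0ℓ} {R′ : REL A′ B′ 0ℓ} {S′ : REL B′ C′ 0ℓ} →
                 Pointwise (R ; S) (R′ ; S′) ⇔ (Pointwise R R′ ; Pointwise S S′)
  Pointwise-; = (λ ((b , r , s) , (b′ , r′ , s′)) → (b , b′) , (r , r′) , (s , s′)) ,
                 (λ (_ , (r , r′) , (s , s′)) → (_ , r , s) , (_ , r′ , s′))

  assocʳ-natural : {R : REL A A′ 0ℓ} {S : REL B B′ 0ℓ} {T : REL C C′ 0ℓ} →
                   (Pointwise (Pointwise R S) T ; Graph assocʳ′) ⇔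
                   (Graph assocʳ′ ; Pointwise R (Pointwise S T))
  assocʳ-natural = (λ { (_ , ((r , s) , t) , refl) → _ , refl , r , s , t }) ,
                   (λ { (_ , refl , r , s , t) → _ , ((r , s) , t) , refl })

module _ {A : Set} where

  duplicate-total : (Graph duplicate ; flip (Graph duplicate)) ⇔ _≡_ {A = A}
  duplicate-total = (λ { (_ , refl , refl) → refl }) , (λ { refl → _ , refl , refl })

  duplicate-natural : {B : Set} {R : REL A B 0ℓ} → Functional R →
                      (R ; Graph duplicate) ⇔ (Graph duplicate ; Pointwise R R)
  duplicate-natural R-functional =
    (λ { (_ , r , refl) → _ , refl , r , r }) ,
    (λ { (_ , refl , r , r′) → _ , r , cong (_ ,_) (R-functional r r′) })

  frobenius₁ : (Pointwise (Graph duplicate) (_≡_ {A = A}) ;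
                (Graph assocʳ′ ; Pointwise _≡_ (flip (Graph duplicate))))
               ⇔ (flip (Graph duplicate) ; Graph duplicate)
  frobenius₁ = (λ { (_ , (refl , refl) , _ , refl , (refl , refl)) → _ , refl , refl }) ,
               (λ { (_ , refl , refl) → _ , (refl , refl) , _ , refl , (refl , refl) })

  frobenius₂ : (flip (Graph duplicate) ; Graph duplicate) ⇔
               (Pointwise (_≡_ {A = A}) (Graph duplicate) ;
                (flip (Graph assocʳ′) ; Pointwise (flip (Graph duplicate)) _≡_))
  frobenius₂ = (λ { (_ , refl , refl) → _ , (refl , refl) , _ , refl , (refl , refl) }) ,
               (λ { (_ , (refl , refl) , _ , refl , (refl , refl)) → _ , refl , refl })

⟦_⟧ : ∀ {A B} → Span A B → REL (Carrier A) (Carrier B) 0ℓ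
⟦ s ⟧ a b = Σ (Carrier (apex s)) λ x → fun (leg s) x ≡ a × fun (map s) x ≡ b

leg-injective : ∀ {A B} (s : Span A B) → Injective _≡_ _≡_ (fun (leg s))
leg-injective s = mono⇒injective {m = leg s} (mono s)

⟦⟧-functional : ∀ {A B} (s : Span A B) → Functional ⟦ s ⟧
⟦⟧-functional s (x , lx≡a , mx≡b) (x′ , lx′≡a , mx′≡b′)
  with refl ← leg-injective s (trans lx≡a (sym lx′≡a)) = trans (sym mx≡b) mx′≡b′

SpanEq⇒⇔ : ∀ {A B} {s t : Span A B} → SpanEq s t → ⟦ s ⟧ ⇔ ⟦ t ⟧
SpanEq⇒⇔ {t = t} s≅t =
  (λ (x , lx≡a , mx≡b) → fun to x , trans (leg-eq x) lx≡a , trans (map-eq x) mx≡b) ,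
  (λ (y , ly≡a , my≡b) → fun from y ,
     trans (sym (leg-eq (fun from y))) (trans (cong (fun (leg t)) (from-to y)) ly≡a) ,
     trans (sym (map-eq (fun from y))) (trans (cong (fun (map t)) (from-to y)) my≡b))
  where open SpanEq s≅t

⇔⇒SpanEq : ∀ {A B} (s t : Span A B) → ⟦ s ⟧ ⇔ ⟦ t ⟧ → SpanEq s t
⇔⇒SpanEq s t (s⊆t , t⊆s) = record
  { to      = to
  ; from    = from
  ; to-from = λ x → leg-injective s (trans (from-leg (fun to x)) (to-leg x))
  ; from-to = λ y → leg-injective t (trans (to-leg (fun from y)) (from-leg y))
  ; leg-eq  = to-leg
  ; map-eq  = λ x → proj₂ (proj₂ (s⊆t (x , refl , refl))) }
  where
  to-leg : ∀ x → fun (leg t) (proj₁ (s⊆t (x , refl , refl))) ≡ fun (leg s) x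
  to-leg x = proj₁ (proj₂ (s⊆t (x , refl , refl)))
  from-leg : ∀ y → fun (leg s) (proj₁ (t⊆s (y , refl , refl))) ≡ fun (leg t) y
  from-leg y = proj₁ (proj₂ (t⊆s (y , refl , refl)))
  to : apex s ⇒ apex t
  to = factor-through-injective (leg t) (leg-injective t) (leg s) _ to-leg
  from : apex t ⇒ apex s
  from = factor-through-injective (leg s) (leg-injective s) (leg t) _ from-leg

-- The pullback property, tested on the one-point torsor, supplies the apex point over a composite pair.
composite-⇔ : ∀ {A B C} (s : Span A B) (t : Span B C) (u : Span A C) →
              IsComposite s t u → ⟦ u ⟧ ⇔ (⟦ s ⟧ ; ⟦ t ⟧)
composite-⇔ s t u (p , q , (square , universal) , p-leg , q-map) =
  (λ (z , lz≡a , mz≡c) → fun (map s) (fun p z) ,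
     (fun p z , trans (p-leg z) lz≡a , refl) , (fun q z , sym (square z) , trans (q-map z) mz≡c)) ,
  (λ (b , (x , lx≡a , mx≡b) , (y , ly≡b , my≡c)) → pair x y (trans mx≡b (sym ly≡b)) lx≡a my≡c)
  where
  pair : ∀ {a c} x y → fun (map s) x ≡ fun (leg t) y →
         fun (leg s) x ≡ a → fun (map t) y ≡ c → ⟦ u ⟧ a c
  pair x y sx≡ty lx≡a my≡c
    with k , kp≗x , kq≗y , _ ← universal (const (apex s) x) (const (apex t) y) (λ _ → sx≡ty) =
    fun k tt ,
    trans (sym (p-leg (fun k tt))) (trans (cong (fun (leg s)) (kp≗x tt)) lx≡a) ,
    trans (sym (q-map (fun k tt))) (trans (cong (fun (map t)) (kq≗y tt)) my≡c)

reverse : ∀ {A B} (s : Span A B) → Injectiveᴿ ⟦ s ⟧ → Span B A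
reverse s s-injective = record
  { apex = apex s ; leg = map s ; map = leg s
  ; mono = injective⇒mono {m = map s} λ {x} {y} mx≡my →
             leg-injective s (s-injective (x , refl , refl) (y , refl , sym mx≡my)) }

⟦reverse⟧ : ∀ {A B} (s : Span A B) (s-injective : Injectiveᴿ ⟦ s ⟧) →
            ⟦ reverse s s-injective ⟧ ⇔ flip ⟦ s ⟧
⟦reverse⟧ s _ = (λ (x , mx≡b , lx≡a) → x , lx≡a , mx≡b) , (λ (x , lx≡a , mx≡b) → x , mx≡b , lx≡a)

⟦restr⟧ : ∀ {A B} (s : Span A B) → Injectiveᴿ ⟦ s ⟧ → ⟦ restr s ⟧ ⇔ (⟦ s ⟧ ; flip ⟦ s ⟧)
⟦restr⟧ s s-injective =
  (λ (x , lx≡a , lx≡a′) → fun (map s) x , (x , lx≡a , refl) , (x , lx≡a′ , refl)) ,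
  (λ (_ , r@(x , lx≡a , _) , r′) → x , lx≡a , trans lx≡a (s-injective r r′))

⟦restr-reverse⟧ : ∀ {A B} (s : Span A B) (s-injective : Injectiveᴿ ⟦ s ⟧) →
                  ⟦ restr (reverse s s-injective) ⟧ ⇔ (flip ⟦ s ⟧ ; ⟦ s ⟧)
⟦restr-reverse⟧ s _ =
  (λ (x , mx≡b , mx≡b′) → fun (leg s) x , (x , refl , mx≡b) , (x , refl , mx≡b′)) ,
  (λ (_ , r@(x , _ , mx≡b) , r′) → x , mx≡b , trans mx≡b (⟦⟧-functional s r r′))

_⊗ˢ_ : ∀ {A B C D} → Span A B → Span C D → Span (A ×ᶜ C) (B ×ᶜ D)
s ⊗ˢ t = record
  { apex = apex s ×ᶜ apex t ; leg = leg s ×ʰ leg t ; map = map s ×ʰ map t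
  ; mono = injective⇒mono {m = leg s ×ʰ leg t} λ e →
             cong₂ _,_ (leg-injective s (cong proj₁ e)) (leg-injective t (cong proj₂ e)) }

⟦⊗ˢ⟧ : ∀ {A B C D} (s : Span A B) (t : Span C D) → ⟦ s ⊗ˢ t ⟧ ⇔ Pointwise ⟦ s ⟧ ⟦ t ⟧
⟦⊗ˢ⟧ s t =
  (λ ((x , y) , l≡a , m≡b) → (x , cong proj₁ l≡a , cong proj₁ m≡b) , (y , cong proj₂ l≡a , cong proj₂ m≡b)) ,
  (λ ((x , lx , mx) , (y , ly , my)) → (x , y) , cong₂ _,_ lx ly , cong₂ _,_ mx my)

graphSpan : ∀ {X Y} → X ⇒ Y → Span X Y
graphSpan {X} h = record { apex = X ; leg = idH ; mono = λ _ _ e → e ; map = h }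

⟦graphSpan⟧ : ∀ {X Y} (h : X ⇒ Y) → ⟦ graphSpan h ⟧ ⇔ Graph (fun h)
⟦graphSpan⟧ h = (λ { (x , refl , hx≡b) → hx≡b }) , (λ hx≡b → _ , refl , hx≡b)

module _ (comp : Compositor) (comp-is-pullback : IsCompositor comp) where

  ⟦comp⟧ : ∀ {A B C} (s : Span A B) (t : Span B C) → ⟦ comp s t ⟧ ⇔ (⟦ s ⟧ ; ⟦ t ⟧)
  ⟦comp⟧ s t = composite-⇔ s t (comp s t) (comp-is-pullback s t)

  -- Opaque, so that comparing morphisms never unfolds these proof terms.
  opaque
    injective⇒parIso : ∀ {A B} (s : Span A B) → Injectiveᴿ ⟦ s ⟧ → IsParIso comp s
    injective⇒parIso s s-injective =
      reverse s s-injective ,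
      ⇔⇒SpanEq _ _ (⇔-trans (⟦comp⟧ s (reverse s s-injective))
        (⇔-trans (;-cong ⇔-refl (⟦reverse⟧ s s-injective)) (⇔-sym (⟦restr⟧ s s-injective)))) ,
      ⇔⇒SpanEq _ _ (⇔-trans (⟦comp⟧ (reverse s s-injective) s)
        (⇔-trans (;-cong (⟦reverse⟧ s s-injective) ⇔-refl) (⇔-sym (⟦restr-reverse⟧ s s-injective))))

    -- If s ⨾ t is the restriction of s, every pair related by s is related back by t.
    parIso⇒injective : ∀ {A B} (s : Span A B) → IsParIso comp s → Injectiveᴿ ⟦ s ⟧
    parIso⇒injective s (t , s⨾t≅restr , _) r r′ = ⟦⟧-functional t (back r) (back r′)
      where
      back : ∀ {a b} → ⟦ s ⟧ a b → ⟦ t ⟧ b a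
      back r@(x , lx≡a , _)
        with _ , r″ , t-pair ← proj₁ (⟦comp⟧ s t) (proj₂ (SpanEq⇒⇔ s⨾t≅restr) (x , lx≡a , lx≡a))
        rewrite ⟦⟧-functional s r″ r = t-pair

  ParIso : CTor2 → CTor2 → Set₁
  ParIso X Y = Σ (Span X Y) (IsParIso comp)

  ⟦_⟧ᴾ : ∀ {X Y} → ParIso X Y → REL (Carrier X) (Carrier Y) 0ℓ
  ⟦ f ⟧ᴾ = ⟦ proj₁ f ⟧

  injective : ∀ {X Y} (f : ParIso X Y) → Injectiveᴿ ⟦ f ⟧ᴾ
  injective (s , s-parIso) = parIso⇒injective s s-parIso

  graphᴾ : ∀ {X Y} (h : X ⇒ Y) → Injective _≡_ _≡_ (fun h) → ParIso X Y
  graphᴾ h h-injective = graphSpan h ,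
    injective⇒parIso _ (Injectiveᴿ-resp-⇔ (⟦graphSpan⟧ h) λ hx≡b hx′≡b → h-injective (trans hx≡b (sym hx′≡b)))

  parIsoClosed : ParIsoClosed comp
  parIsoClosed = record
    { idP   = λ X → proj₂ (graphᴾ (idH {X}) λ x≡x′ → x≡x′)
    ; compP = λ {_} {_} {_} {s} {t} s-parIso t-parIso →
        injective⇒parIso (comp s t) (Injectiveᴿ-resp-⇔ (⟦comp⟧ s t)
          (Injectiveᴿ-; {R = ⟦ s ⟧} {S = ⟦ t ⟧} (parIso⇒injective s s-parIso) (parIso⇒injective t t-parIso))) }

  open ParIsoClosed parIsoClosed

  idᴾ : ∀ X → ParIso X X
  idᴾ X = idSpan X , idP X

  infixr 9 _⨾ᴾ_
  _⨾ᴾ_ : ∀ {X Y Z} → ParIso X Y → ParIso Y Z → ParIso X Z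
  f ⨾ᴾ g = comp (proj₁ f) (proj₁ g) , compP (proj₂ f) (proj₂ g)

  _ᴾ° : ∀ {X Y} → ParIso X Y → ParIso Y X
  f ᴾ° = reverse (proj₁ f) (injective f) ,
         injective⇒parIso _ (Injectiveᴿ-resp-⇔ (⟦reverse⟧ (proj₁ f) (injective f)) (⟦⟧-functional (proj₁ f)))

  infixr 10 _⊗ᴾ_
  _⊗ᴾ_ : ∀ {X Y Z W} → ParIso X Y → ParIso Z W → ParIso (X ×ᶜ Z) (Y ×ᶜ W)
  f ⊗ᴾ g = proj₁ f ⊗ˢ proj₁ g ,
           injective⇒parIso _ (Injectiveᴿ-resp-⇔ (⟦⊗ˢ⟧ (proj₁ f) (proj₁ g))
                                 (Injectiveᴿ-Pointwise {R = ⟦ f ⟧ᴾ} {S = ⟦ g ⟧ᴾ} (injective f) (injective g)))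

  -- Indexed by CTor2, not Obj: a morphism fixes the torsors it connects but not their
  -- non-emptiness proofs, so only CTor2 endpoints can be inferred.
  infixr 9 _⨾ₜ_
  infixr 10 _⊗ₜ_
  infix 11 _ᵒ
  data Term : CTor2 → CTor2 → Set₁ where
    ⌜_⌝   : ∀ {X Y} → ParIso X Y → Term X Y
    graph : ∀ {X Y} (h : X ⇒ Y) → Injective _≡_ _≡_ (fun h) → Term X Y
    idₜ   : ∀ {X} → Term X X
    _⨾ₜ_  : ∀ {X Y Z} → Term X Y → Term Y Z → Term X Z
    _⊗ₜ_  : ∀ {X Y Z W} → Term X Y → Term Z W → Term (X ×ᶜ Z) (Y ×ᶜ W)
    _ᵒ    : ∀ {X Y} → Term X Y → Term Y X

  eval : ∀ {X Y} → Term X Y → ParIso X Y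
  eval ⌜ f ⌝                 = f
  eval (graph h h-injective) = graphᴾ h h-injective
  eval (idₜ {X})             = idᴾ X
  eval (e ⨾ₜ e′)             = eval e ⨾ᴾ eval e′
  eval (e ⊗ₜ e′)             = eval e ⊗ᴾ eval e′
  eval (e ᵒ)                 = eval e ᴾ°

  ⟦_⟧ₜ : ∀ {X Y} → Term X Y → REL (Carrier X) (Carrier Y) 0ℓ
  ⟦ ⌜ f ⌝ ⟧ₜ     = ⟦ f ⟧ᴾ
  ⟦ graph h _ ⟧ₜ = Graph (fun h)
  ⟦ idₜ ⟧ₜ       = _≡_
  ⟦ e ⨾ₜ e′ ⟧ₜ   = ⟦ e ⟧ₜ ; ⟦ e′ ⟧ₜ
  ⟦ e ⊗ₜ e′ ⟧ₜ   = Pointwise ⟦ e ⟧ₜ ⟦ e′ ⟧ₜ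
  ⟦ e ᵒ ⟧ₜ       = flip ⟦ e ⟧ₜ

  ⟦eval⟧ : ∀ {X Y} (e : Term X Y) → ⟦ eval e ⟧ᴾ ⇔ ⟦ e ⟧ₜ
  ⟦eval⟧ ⌜ f ⌝       = ⇔-refl
  ⟦eval⟧ (graph h _) = ⟦graphSpan⟧ h
  ⟦eval⟧ (idₜ {X})   = ⟦graphSpan⟧ (idH {X})
  ⟦eval⟧ (e ⨾ₜ e′)   = ⇔-trans (⟦comp⟧ (proj₁ (eval e)) (proj₁ (eval e′))) (;-cong (⟦eval⟧ e) (⟦eval⟧ e′))
  ⟦eval⟧ (e ⊗ₜ e′)   = ⇔-trans (⟦⊗ˢ⟧ (proj₁ (eval e)) (proj₁ (eval e′))) (Pointwise-cong (⟦eval⟧ e) (⟦eval⟧ e′))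
  ⟦eval⟧ (e ᵒ)       = ⇔-trans (⟦reverse⟧ (proj₁ (eval e)) (injective (eval e))) (flip-cong (⟦eval⟧ e))

  infix 4 _≈ₜ_
  _≈ₜ_ : ∀ {X Y} → Term X Y → Term X Y → Set
  e ≈ₜ e′ = SpanEq (proj₁ (eval e)) (proj₁ (eval e′))

  by-relations : ∀ {X Y} (e e′ : Term X Y) → ⟦ e ⟧ₜ ⇔ ⟦ e′ ⟧ₜ → e ≈ₜ e′
  by-relations e e′ e⇔e′ = ⇔⇒SpanEq _ _ (⇔-trans (⟦eval⟧ e) (⇔-trans e⇔e′ (⇔-sym (⟦eval⟧ e′))))

  IsGraph : ∀ {X Y} → Term X Y → Set
  IsGraph ⌜ _ ⌝       = ⊥
  IsGraph (graph _ _) = ⊤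
  IsGraph idₜ         = ⊤
  IsGraph (e ⨾ₜ e′)   = IsGraph e × IsGraph e′
  IsGraph (e ⊗ₜ e′)   = IsGraph e × IsGraph e′
  IsGraph (_ ᵒ)       = ⊥

  function : ∀ {X Y} (e : Term X Y) → IsGraph e → Carrier X → Carrier Y
  function (graph h _) _          = fun h
  function idₜ _                  = λ x → x
  function (e ⨾ₜ e′) (e-g , e′-g) = λ x → function e′ e′-g (function e e-g x)
  function (e ⊗ₜ e′) (e-g , e′-g) = λ p → function e e-g (proj₁ p) , function e′ e′-g (proj₂ p)

  ⟦⟧ₜ-graph : ∀ {X Y} (e : Term X Y) (e-g : IsGraph e) → ⟦ e ⟧ₜ ⇔ Graph (function e e-g)
  ⟦⟧ₜ-graph (graph _ _) _          = ⇔-refl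
  ⟦⟧ₜ-graph idₜ _                  = ⇔-refl
  ⟦⟧ₜ-graph (e ⨾ₜ e′) (e-g , e′-g) = ⇔-trans (;-cong (⟦⟧ₜ-graph e e-g) (⟦⟧ₜ-graph e′ e′-g)) Graph-;
  ⟦⟧ₜ-graph (e ⊗ₜ e′) (e-g , e′-g) =
    ⇔-trans (Pointwise-cong (⟦⟧ₜ-graph e e-g) (⟦⟧ₜ-graph e′ e′-g)) Graph-Pointwise

  -- The witnesses of IsGraph are tuples of tt, found by η-expansion.
  by-functions : ∀ {X Y} (e e′ : Term X Y) {e-g : IsGraph e} {e′-g : IsGraph e′} →
                 (∀ x → function e e-g x ≡ function e′ e′-g x) → e ≈ₜ e′
  by-functions e e′ {e-g} {e′-g} e≗e′ =
    by-relations e e′ (⇔-trans (⟦⟧ₜ-graph e e-g) (⇔-trans (Graph-cong e≗e′) (⇔-sym (⟦⟧ₜ-graph e′ e′-g))))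

  Obj : Set₁
  Obj = Σ CTor2 NonEmpty

  ∣_∣ : Obj → CTor2
  ∣_∣ = proj₁

  infixr 10 _⊗ₒ_
  _⊗ₒ_ : Obj → Obj → Obj
  (X , X-nonempty) ⊗ₒ (Y , Y-nonempty) =
    X ×ᶜ Y , λ no-pair → X-nonempty λ x → Y-nonempty λ y → no-pair (x , y)

  unitₒ : Obj
  unitₒ = point , λ no-point → no-point tt

  αₜ : ∀ A B C → Term ((∣ A ∣ ×ᶜ ∣ B ∣) ×ᶜ ∣ C ∣) (∣ A ∣ ×ᶜ (∣ B ∣ ×ᶜ ∣ C ∣))
  αₜ A B C = graph (assocʳʰ {∣ A ∣} {∣ B ∣} {∣ C ∣}) (cong assocˡ′)

  α⁻¹ₜ : ∀ A B C → Term (∣ A ∣ ×ᶜ (∣ B ∣ ×ᶜ ∣ C ∣)) ((∣ A ∣ ×ᶜ ∣ B ∣) ×ᶜ ∣ C ∣)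
  α⁻¹ₜ A B C = graph (assocˡʰ {∣ A ∣} {∣ B ∣} {∣ C ∣}) (cong assocʳ′)

  σₜ : ∀ A B → Term (∣ A ∣ ×ᶜ ∣ B ∣) (∣ B ∣ ×ᶜ ∣ A ∣)
  σₜ A B = graph (swapʰ {∣ A ∣} {∣ B ∣}) (cong swap)

  luₜ : ∀ A → Term (point ×ᶜ ∣ A ∣) ∣ A ∣
  luₜ A = graph (proj₂ʰ {∣ A ∣}) (cong (tt ,_))

  lu⁻¹ₜ : ∀ A → Term ∣ A ∣ (point ×ᶜ ∣ A ∣)
  lu⁻¹ₜ A = graph (insertˡʰ {∣ A ∣}) (cong proj₂)

  ruₜ : ∀ A → Term (∣ A ∣ ×ᶜ point) ∣ A ∣
  ruₜ A = graph (proj₁ʰ {∣ A ∣}) (cong (_, tt))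

  ru⁻¹ₜ : ∀ A → Term ∣ A ∣ (∣ A ∣ ×ᶜ point)
  ru⁻¹ₜ A = graph (insertʳʰ {∣ A ∣}) (cong proj₁)

  Δₜ : ∀ A → Term ∣ A ∣ (∣ A ∣ ×ᶜ ∣ A ∣)
  Δₜ A = graph (duplicateʰ {∣ A ∣}) (cong proj₁)

  isCategory : IsCategory (ParIsoStar comp parIsoClosed)
  isCategory = record
    { ≈-refl  = ⇔⇒SpanEq _ _ ⇔-refl
    ; ≈-sym   = λ f≈g → ⇔⇒SpanEq _ _ (⇔-sym (SpanEq⇒⇔ f≈g))
    ; ≈-trans = λ f≈g g≈h → ⇔⇒SpanEq _ _ (⇔-trans (SpanEq⇒⇔ f≈g) (SpanEq⇒⇔ g≈h))
    ; ⨾-cong  = λ {_} {_} {_} {f} {f′} {g} {g′} f≈f′ g≈g′ →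
        by-relations (⌜ f ⌝ ⨾ₜ ⌜ g ⌝) (⌜ f′ ⌝ ⨾ₜ ⌜ g′ ⌝) (;-cong (SpanEq⇒⇔ f≈f′) (SpanEq⇒⇔ g≈g′))
    ; idˡ     = λ f → by-relations (idₜ ⨾ₜ ⌜ f ⌝) ⌜ f ⌝ ;-identityˡ
    ; idʳ     = λ f → by-relations (⌜ f ⌝ ⨾ₜ idₜ) ⌜ f ⌝ ;-identityʳ
    ; assoc   = λ f g h → by-relations ((⌜ f ⌝ ⨾ₜ ⌜ g ⌝) ⨾ₜ ⌜ h ⌝) (⌜ f ⌝ ⨾ₜ ⌜ g ⌝ ⨾ₜ ⌜ h ⌝) ;-assoc }

  discreteInverse : DiscreteInverse (ParIsoStar comp parIsoClosed)
  discreteInverse = record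
    { _°         = _ᴾ°
    ; °-cong     = λ {_} {_} {f} {g} f≈g → by-relations (⌜ f ⌝ ᵒ) (⌜ g ⌝ ᵒ) (flip-cong (SpanEq⇒⇔ f≈g))
    ; °-id       = λ {A} → by-relations (idₜ {∣ A ∣} ᵒ) idₜ flip-≡
    ; °-⨾        = λ f g → by-relations ((⌜ f ⌝ ⨾ₜ ⌜ g ⌝) ᵒ) (⌜ g ⌝ ᵒ ⨾ₜ ⌜ f ⌝ ᵒ) flip-;
    ; °-°        = λ f → by-relations (⌜ f ⌝ ᵒ ᵒ) ⌜ f ⌝ ⇔-refl
    ; c°c        = λ f → by-relations (⌜ f ⌝ ⨾ₜ ⌜ f ⌝ ᵒ ⨾ₜ ⌜ f ⌝) ⌜ f ⌝ (;-flip-;-injective (injective f))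
    ; restr-comm = λ f g →
        by-relations ((⌜ f ⌝ ⨾ₜ ⌜ f ⌝ ᵒ) ⨾ₜ (⌜ g ⌝ ⨾ₜ ⌜ g ⌝ ᵒ)) ((⌜ g ⌝ ⨾ₜ ⌜ g ⌝ ᵒ) ⨾ₜ (⌜ f ⌝ ⨾ₜ ⌜ f ⌝ ᵒ))
          (restrictions-commute (injective f) (injective g) , restrictions-commute (injective g) (injective f))
    ; _⊗₀_       = _⊗ₒ_
    ; _⊗₁_       = _⊗ᴾ_
    ; I          = unitₒ
    ; ⊗-cong     = λ {_} {_} {_} {_} {f} {f′} {g} {g′} f≈f′ g≈g′ →
        by-relations (⌜ f ⌝ ⊗ₜ ⌜ g ⌝) (⌜ f′ ⌝ ⊗ₜ ⌜ g′ ⌝) (Pointwise-cong (SpanEq⇒⇔ f≈f′) (SpanEq⇒⇔ g≈g′))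
    ; ⊗-id       = λ {A} {B} → by-functions (idₜ {∣ A ∣} ⊗ₜ idₜ {∣ B ∣}) idₜ λ _ → refl
    ; ⊗-⨾        = λ f g f′ g′ →
        by-relations ((⌜ f ⌝ ⨾ₜ ⌜ g ⌝) ⊗ₜ (⌜ f′ ⌝ ⨾ₜ ⌜ g′ ⌝)) ((⌜ f ⌝ ⊗ₜ ⌜ f′ ⌝) ⨾ₜ (⌜ g ⌝ ⊗ₜ ⌜ g′ ⌝))
          Pointwise-;
    ; α          = λ A B C → eval (αₜ A B C)
    ; α⁻¹        = λ A B C → eval (α⁻¹ₜ A B C)
    ; lu         = λ A → eval (luₜ A)
    ; lu⁻¹       = λ A → eval (lu⁻¹ₜ A)
    ; ru         = λ A → eval (ruₜ A)
    ; ru⁻¹       = λ A → eval (ru⁻¹ₜ A)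
    ; σ          = λ A B → eval (σₜ A B)
    ; α-iso₁     = λ A B C → by-functions (αₜ A B C ⨾ₜ α⁻¹ₜ A B C) idₜ λ _ → refl
    ; α-iso₂     = λ A B C → by-functions (α⁻¹ₜ A B C ⨾ₜ αₜ A B C) idₜ λ _ → refl
    ; lu-iso₁    = λ A → by-functions (luₜ A ⨾ₜ lu⁻¹ₜ A) idₜ λ _ → refl
    ; lu-iso₂    = λ A → by-functions (lu⁻¹ₜ A ⨾ₜ luₜ A) idₜ λ _ → refl
    ; ru-iso₁    = λ A → by-functions (ruₜ A ⨾ₜ ru⁻¹ₜ A) idₜ λ _ → refl
    ; ru-iso₂    = λ A → by-functions (ru⁻¹ₜ A ⨾ₜ ruₜ A) idₜ λ _ → refl
    ; σ-inv      = λ A B → by-functions (σₜ A B ⨾ₜ σₜ B A) idₜ λ _ → refl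
    ; α-nat      = λ {A₁} {A₂} {A₃} {B₁} {B₂} {B₃} f g h →
        by-relations (((⌜ f ⌝ ⊗ₜ ⌜ g ⌝) ⊗ₜ ⌜ h ⌝) ⨾ₜ αₜ B₁ B₂ B₃) (αₜ A₁ A₂ A₃ ⨾ₜ (⌜ f ⌝ ⊗ₜ ⌜ g ⌝ ⊗ₜ ⌜ h ⌝))
          assocʳ-natural
    ; lu-nat     = λ {A} {B} f → by-relations ((idₜ {point} ⊗ₜ ⌜ f ⌝) ⨾ₜ luₜ B) (luₜ A ⨾ₜ ⌜ f ⌝) proj₂-natural
    ; ru-nat     = λ {A} {B} f → by-relations ((⌜ f ⌝ ⊗ₜ idₜ {point}) ⨾ₜ ruₜ B) (ruₜ A ⨾ₜ ⌜ f ⌝) proj₁-natural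
    ; σ-nat      = λ {A₁} {A₂} {B₁} {B₂} f g →
        by-relations ((⌜ f ⌝ ⊗ₜ ⌜ g ⌝) ⨾ₜ σₜ B₁ B₂) (σₜ A₁ A₂ ⨾ₜ (⌜ g ⌝ ⊗ₜ ⌜ f ⌝)) swap-natural
    ; pentagon   = λ A B C D →
        by-functions (αₜ (A ⊗ₒ B) C D ⨾ₜ αₜ A B (C ⊗ₒ D))
                     ((αₜ A B C ⊗ₜ idₜ {∣ D ∣}) ⨾ₜ αₜ A (B ⊗ₒ C) D ⨾ₜ (idₜ {∣ A ∣} ⊗ₜ αₜ B C D)) λ _ → refl
    ; triangle   = λ A B →
        by-functions (αₜ A unitₒ B ⨾ₜ (idₜ {∣ A ∣} ⊗ₜ luₜ B)) (ruₜ A ⊗ₜ idₜ {∣ B ∣}) λ _ → refl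
    ; hexagon    = λ A B C →
        by-functions (αₜ A B C ⨾ₜ σₜ A (B ⊗ₒ C) ⨾ₜ αₜ B C A)
                     ((σₜ A B ⊗ₜ idₜ {∣ C ∣}) ⨾ₜ αₜ B A C ⨾ₜ (idₜ {∣ B ∣} ⊗ₜ σₜ A C)) λ _ → refl
    ; ⊗-°        = λ f g → by-relations ((⌜ f ⌝ ⊗ₜ ⌜ g ⌝) ᵒ) (⌜ f ⌝ ᵒ ⊗ₜ ⌜ g ⌝ ᵒ) flip-Pointwise
    ; Δ          = λ A → eval (Δₜ A)
    ; Δ-total    = λ A → by-relations (Δₜ A ⨾ₜ Δₜ A ᵒ) idₜ duplicate-total
    ; Δ-nat      = λ {A} {B} f →
        by-relations (⌜ f ⌝ ⨾ₜ Δₜ B) (Δₜ A ⨾ₜ (⌜ f ⌝ ⊗ₜ ⌜ f ⌝)) (duplicate-natural (⟦⟧-functional (proj₁ f)))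
    ; Δ-cocomm   = λ A → by-functions (Δₜ A ⨾ₜ σₜ A A) (Δₜ A) λ _ → refl
    ; Δ-coassoc  = λ A →
        by-functions (Δₜ A ⨾ₜ (Δₜ A ⊗ₜ idₜ {∣ A ∣}) ⨾ₜ αₜ A A A) (Δₜ A ⨾ₜ (idₜ {∣ A ∣} ⊗ₜ Δₜ A)) λ _ → refl
    ; Δ-frob₁    = λ A →
        by-relations ((Δₜ A ⊗ₜ idₜ {∣ A ∣}) ⨾ₜ αₜ A A A ⨾ₜ (idₜ {∣ A ∣} ⊗ₜ Δₜ A ᵒ)) (Δₜ A ᵒ ⨾ₜ Δₜ A) frobenius₁
    ; Δ-frob₂    = λ A →
        by-relations (Δₜ A ᵒ ⨾ₜ Δₜ A) ((idₜ {∣ A ∣} ⊗ₜ Δₜ A) ⨾ₜ αₜ A A A ᵒ ⨾ₜ (Δₜ A ᵒ ⊗ₜ idₜ {∣ A ∣})) frobenius₂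
    ; Δ-uniform  = λ A B →
        by-functions (Δₜ (A ⊗ₒ B))
          ((Δₜ A ⊗ₜ Δₜ B) ⨾ₜ αₜ A A (B ⊗ₒ B) ⨾ₜ (idₜ {∣ A ∣} ⊗ₜ α⁻¹ₜ A B B) ⨾ₜ
           (idₜ {∣ A ∣} ⊗ₜ (σₜ A B ⊗ₜ idₜ {∣ B ∣})) ⨾ₜ (idₜ {∣ A ∣} ⊗ₜ αₜ B A B) ⨾ₜ α⁻¹ₜ A B (A ⊗ₒ B)) λ _ → refl }

mainTheorem4 : (comp : Compositor) → IsCompositor comp →
    Σ (ParIsoClosed comp) (λ cl → IsCategory (ParIsoStar comp cl) × DiscreteInverse (ParIsoStar comp cl))
mainTheorem4 comp comp-is-pullback =
  parIsoClosed comp comp-is-pullback ,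
  isCategory comp comp-is-pullback ,
  discreteInverse comp comp-is-pullback
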